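{- Let $\mathcal{G}$ be a proper minor-closed family of graphs and let $s$ be the minimum integer such that $K_{s,t}\notin\mathcal{G}$ for some positive integer $t$. Then for every positive integer $k$ there is an $(s-1)$-connected graph $G\in\mathcal{G}$ which is not $k$-truncated-degree-choosable.
   Context: A family of graphs is minor-closed if it contains every minor of each of its members, and proper if it does not contain all graphs. A graph $G$ is $k$-truncated-degree-choosable if for every assignment of lists $L(v)$ of colours with $|L(v)|\ge\min\{k,d_G(v)\}$ for each vertex $v$, there is a proper colouring $\phi$ of $G$ with $\phi(v)\in L(v)$ for all $v$. -}

module Defs where

open import Data.Nat using (ℕ; zero; suc; _+_; _≤_; _<_; _<ᵇ_; _⊔_; _⊓_)
open import Data.Fin using (Fin; toℕ)
open import Data.Fin.Subset using (Subset; _∉_; ∣_∣)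
open import Data.Bool using (Bool; true; false; if_then_else_; _xor_)
open import Data.Bool.Properties using (xor-same)
open import Data.List using (List; allFin; map; length)
open import Data.Nat.ListAction using (sum)
open import Data.List.Membership.Propositional using () renaming (_∈_ to _∈ᴸ_)
open import Data.List.Relation.Unary.Unique.Propositional using (Unique)
open import Data.Maybe using (Maybe; just)
open import Data.Product using (Σ; ∃; ∃₂; _×_; _,_)
open import Relation.Nullary using (¬_)
open import Relation.Binary.PropositionalEquality using (_≡_; _≢_; refl)

record Graph : Set where
  field
    n      : ℕ
    adj    : Fin n → Fin n → Bool
    adj-sym    : ∀ u v → adj u v ≡ adj v u
    adj-irrefl : ∀ v → adj v v ≡ false
open Graph public

Edge : (G : Graph) → Fin (n G) → Fin (n G) → Set
Edge G u v = adj G u v ≡ true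

degree : (G : Graph) → Fin (n G) → ℕ
degree G v = sum (map (λ u → if adj G v u then 1 else 0) (allFin (n G)))

data Reach (G : Graph) (P : Fin (n G) → Set) : Fin (n G) → Fin (n G) → Set where
  here : ∀ {u} → P u → Reach G P u u
  step : ∀ {u v w} → P u → Edge G u v → Reach G P v w → Reach G P u w

-- H is a minor of G: a model of H in G given by branch sets
-- (the branch set of h is { x | branch x ≡ just h }; they are disjoint since
-- branch is a function), each nonempty and connected, and every edge of H is
-- realised by an edge of G between the corresponding branch sets.
record Minor (H G : Graph) : Set where
  field
    branch    : Fin (n G) → Maybe (Fin (n H))
    nonempty  : ∀ h → ∃ λ x → branch x ≡ just h
    connected : ∀ h x y → branch x ≡ just h → branch y ≡ just h →
                Reach G (λ z → branch z ≡ just h) x y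
    edges     : ∀ h h' → Edge H h h' →
                ∃₂ λ x y → branch x ≡ just h × branch y ≡ just h' × Edge G x y

Family : Set₁
Family = Graph → Set

MinorClosed : Family → Set
MinorClosed 𝒢 = ∀ G H → Minor H G → 𝒢 G → 𝒢 H

Proper : Family → Set
Proper 𝒢 = ∃ λ G → ¬ 𝒢 G

-- complete bipartite graph K_{s,t}: vertices 0..s-1 on one side, s..s+t-1 on the other
K : ℕ → ℕ → Graph
K s t = record
  { n = s + t
  ; adj = λ i j → (toℕ i <ᵇ s) xor (toℕ j <ᵇ s)
  ; adj-sym = λ i j → xor-comm (toℕ i <ᵇ s) (toℕ j <ᵇ s)
  ; adj-irrefl = λ i → xor-same (toℕ i <ᵇ s)
  }
  where
  xor-comm : ∀ a b → a xor b ≡ b xor a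
  xor-comm false false = refl
  xor-comm false true  = refl
  xor-comm true  false = refl
  xor-comm true  true  = refl

Connected : ℕ → Graph → Set
Connected k G = k < n G ×
  (∀ (X : Subset (n G)) → ∣ X ∣ < k →
     ∀ u v → u ∉ X → v ∉ X → Reach G (λ z → z ∉ X) u v)

-- k-truncated-degree-choosable; colours are natural numbers, a list of colours
-- is a duplicate-free list, so |L(v)| is its length.
TruncDegChoosable : ℕ → Graph → Set
TruncDegChoosable k G =
  ∀ (L : Fin (n G) → List ℕ) → (∀ v → Unique (L v)) →
  (∀ v → k ⊓ degree G v ≤ length (L v)) →
  Σ (Fin (n G) → ℕ) λ φ → (∀ v → φ v ∈ᴸ L v) × (∀ u v → Edge G u v → φ u ≢ φ v)

-- Take K_{a,t} with a = s − 1 (for s = 0 this is a single vertex, a minor of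
-- any nonempty member), so that it lies in the family and is a-connected as
-- soon as t ≥ a.  Split the colours into a blocks of q = k
-- colours each and give the i-th vertex of the small side the i-th block.
-- The big side has a vertex for each of the q^a transversals of the blocks,
-- and it receives that transversal as its list; it has degree a, so a list
-- of length a suffices.  Whatever colours the small side picks form a
-- transversal, and the big vertex carrying it has no colour left.
module Submission where

open import Defs
open import Data.Nat using (ℕ; _<_; _≤_; _∸_)
open import Data.Product using (∃; _×_)
open import Relation.Nullary using (¬_)

open import Data.Nat using (zero; suc; _+_; _^_; _<ᵇ_; _⊓_; z≤n; s≤s)
open import Data.Nat.Properties
  using (≤-refl; ≤-reflexive; ≤-trans; <⇒≱; m<m+n; m≤m+n; m≤n+m; m^n>0; m⊓n≤m; m⊓n≤n)
open import Data.Nat.ListAction using (sum)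
open import Data.Bool using (true; false; if_then_else_; _xor_)
open import Data.Fin using (Fin; toℕ; fromℕ<; _↑ˡ_; _↑ʳ_; splitAt; combine; finToFun; funToFin; _≟_)
  renaming (zero to fzero; suc to fsuc)
open import Data.Fin.Properties
  using (toℕ-injective; combine-injective; splitAt-↑ˡ; splitAt-↑ʳ; splitAt⁻¹-↑ˡ; splitAt⁻¹-↑ʳ;
         finToFun-funToFin; ¬∀⟶∃¬)
open import Data.Fin.Subset using (Subset; _∈_; _∉_; ∣_∣; ⊤)
open import Data.Fin.Subset.Properties using (_∈?_; drop-there; ∣p∣≤∣x∷p∣; ∣⊤∣≡n; p⊆q⇒∣p∣≤∣q∣)
open import Data.Vec using (_∷_; here)
open import Data.List using (List; map; length; tabulate; allFin)
open import Data.List.Properties using (map-tabulate; map-cong; length-map; length-tabulate)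
open import Data.List.Relation.Unary.Unique.Propositional using (Unique)
open import Data.List.Relation.Unary.Unique.Propositional.Properties using (map⁺; allFin⁺)
open import Data.List.Membership.Propositional using () renaming (_∈_ to _∈ᴸ_)
open import Data.List.Membership.Propositional.Properties using (∈-map⁻)
open import Data.Maybe using (Maybe; just; nothing)
open import Data.Product using (_,_; proj₁; proj₂)
open import Data.Empty using (⊥; ⊥-elim)
open import Data.Sum using (inj₁; inj₂; [_,_]′)
open import Function using (_∘_)
open import Relation.Nullary using (yes; no)
open import Relation.Binary.PropositionalEquality
  using (_≡_; refl; sym; trans; cong; cong₂; subst; module ≡-Reasoning)

↑ˡ-<ᵇ : ∀ {a} t (i : Fin a) → (toℕ (i ↑ˡ t) <ᵇ a) ≡ true
↑ˡ-<ᵇ t fzero    = refl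
↑ˡ-<ᵇ t (fsuc i) = ↑ˡ-<ᵇ t i

↑ʳ-≮ᵇ : ∀ a {t} (j : Fin t) → (toℕ (a ↑ʳ j) <ᵇ a) ≡ false
↑ʳ-≮ᵇ zero    j = refl
↑ʳ-≮ᵇ (suc a) j = ↑ʳ-≮ᵇ a j

data Side (a t : ℕ) : Fin (a + t) → Set where
  left  : (i : Fin a) → Side a t (i ↑ˡ t)
  right : (j : Fin t) → Side a t (a ↑ʳ j)

side : ∀ a t (u : Fin (a + t)) → Side a t u
side a t u with splitAt a u in eq
... | inj₁ i = subst (Side a t) (splitAt⁻¹-↑ˡ eq) (left i)
... | inj₂ j = subst (Side a t) (splitAt⁻¹-↑ʳ eq) (right j)

K-edge : ∀ a t (i : Fin a) (j : Fin t) → Edge (K a t) (i ↑ˡ t) (a ↑ʳ j)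
K-edge a t i j = cong₂ _xor_ (↑ˡ-<ᵇ t i) (↑ʳ-≮ᵇ a j)

K-edge′ : ∀ a t (i : Fin a) (j : Fin t) → Edge (K a t) (a ↑ʳ j) (i ↑ˡ t)
K-edge′ a t i j = cong₂ _xor_ (↑ʳ-≮ᵇ a j) (↑ˡ-<ᵇ t i)

count-<ᵇ : ∀ m a → sum (tabulate {n = m} (λ u → if toℕ u <ᵇ a then 1 else 0)) ≤ a
count-<ᵇ zero    a       = z≤n
count-<ᵇ (suc m) zero    = count-<ᵇ m zero
count-<ᵇ (suc m) (suc a) = s≤s (count-<ᵇ m a)

K-degree-↑ʳ : ∀ a t (j : Fin t) → degree (K a t) (a ↑ʳ j) ≤ a
K-degree-↑ʳ a t j = subst (_≤ a) (sym degree≡count) (count-<ᵇ (a + t) a)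
  where
  degree≡count : degree (K a t) (a ↑ʳ j)
               ≡ sum (tabulate {n = a + t} (λ u → if toℕ u <ᵇ a then 1 else 0))
  degree≡count rewrite ↑ʳ-≮ᵇ a j =
    cong sum (map-tabulate {n = a + t} (λ u → u) (λ u → if toℕ u <ᵇ a then 1 else 0))

⊇↑ˡ⇒≤∣∣ : ∀ {a t} (X : Subset (a + t)) → (∀ i → i ↑ˡ t ∈ X) → a ≤ ∣ X ∣
⊇↑ˡ⇒≤∣∣ {zero}  X       _ = z≤n
⊇↑ˡ⇒≤∣∣ {suc a} (x ∷ X) h with h fzero
... | here = s≤s (⊇↑ˡ⇒≤∣∣ X (drop-there ∘ h ∘ fsuc))

⊇↑ʳ⇒≤∣∣ : ∀ a {t} (X : Subset (a + t)) → (∀ j → a ↑ʳ j ∈ X) → t ≤ ∣ X ∣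
⊇↑ʳ⇒≤∣∣ zero    {t} X       h =
  subst (_≤ ∣ X ∣) (∣⊤∣≡n t) (p⊆q⇒∣p∣≤∣q∣ {p = ⊤} (λ {x} _ → h x))
⊇↑ʳ⇒≤∣∣ (suc a)     (x ∷ X) h = ≤-trans (⊇↑ʳ⇒≤∣∣ a X (drop-there ∘ h)) (∣p∣≤∣x∷p∣ x X)

missing-↑ˡ : ∀ {a t} (X : Subset (a + t)) → ∣ X ∣ < a → ∃ λ i → i ↑ˡ t ∉ X
missing-↑ˡ {a} {t} X ∣X∣<a =
  ¬∀⟶∃¬ a (λ i → i ↑ˡ t ∈ X) (λ i → i ↑ˡ t ∈? X) (<⇒≱ ∣X∣<a ∘ ⊇↑ˡ⇒≤∣∣ X)

missing-↑ʳ : ∀ a {t} (X : Subset (a + t)) → ∣ X ∣ < t → ∃ λ j → a ↑ʳ j ∉ X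
missing-↑ʳ a {t} X ∣X∣<t =
  ¬∀⟶∃¬ t (λ j → a ↑ʳ j ∈ X) (λ j → a ↑ʳ j ∈? X) (<⇒≱ ∣X∣<t ∘ ⊇↑ʳ⇒≤∣∣ a X)

K-connected : ∀ a t → 1 ≤ t → a ≤ t → Connected a (K a t)
K-connected a t 1≤t a≤t = m<m+n a 1≤t , reach
  where
  reach : ∀ (X : Subset (a + t)) → ∣ X ∣ < a →
          ∀ u v → u ∉ X → v ∉ X → Reach (K a t) (_∉ X) u v
  reach X ∣X∣<a u v u∉X v∉X with side a t u | side a t v
  ... | left i  | right j = step u∉X (K-edge a t i j) (here v∉X)
  ... | right j | left i  = step u∉X (K-edge′ a t i j) (here v∉X)
  ... | left i  | left i′ with j , j∉X ← missing-↑ʳ a X (≤-trans ∣X∣<a a≤t) =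
    step u∉X (K-edge a t i j) (step j∉X (K-edge′ a t i′ j) (here v∉X))
  ... | right j | right j′ with i , i∉X ← missing-↑ˡ X ∣X∣<a =
    step u∉X (K-edge′ a t i j) (step i∉X (K-edge a t i j′) (here v∉X))

K₀₁-minor : (G : Graph) → Fin (n G) → Minor (K 0 1) G
K₀₁-minor G v = record
  { branch    = branch
  ; nonempty  = λ { fzero → v , branch-v }
  ; connected = connected
  ; edges     = λ { fzero fzero () }
  }
  where
  branch : Fin (n G) → Maybe (Fin 1)
  branch x with x ≟ v
  ... | yes _ = just fzero
  ... | no _  = nothing

  branch-v : branch v ≡ just fzero
  branch-v with v ≟ v
  ... | yes _  = refl
  ... | no v≢v = ⊥-elim (v≢v refl)

  branch⁻¹ : ∀ {x h} → branch x ≡ just h → x ≡ v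
  branch⁻¹ {x} _  with x ≟ v
  branch⁻¹ {x} _  | yes x≡v = x≡v
  branch⁻¹ {x} () | no _

  connected : ∀ h x y → branch x ≡ just h → branch y ≡ just h →
              Reach G (λ z → branch z ≡ just h) x y
  connected h x y bx by with refl ← branch⁻¹ bx | refl ← branch⁻¹ by = here bx

module TransversalLists (a k : ℕ) where

  q t : ℕ
  q = suc k
  t = q ^ a + a

  -- colour i d is the d-th colour of the i-th block, i.e. i * q + d
  colour : Fin a → Fin q → ℕ
  colour i d = toℕ (combine i d)

  colour-injective : ∀ {i i′ d d′} → colour i d ≡ colour i′ d′ → i ≡ i′ × d ≡ d′
  colour-injective {i} {i′} {d} {d′} e = combine-injective i d i′ d′ (toℕ-injective e)

  block : Fin a → List ℕ
  block i = map (colour i) (allFin q)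

  transversal : (Fin a → Fin q) → List ℕ
  transversal f = map (λ i → colour i (f i)) (allFin a)

  -- the last a vertices of the big side are there only to make t ≥ a;
  -- they carry an arbitrary transversal
  choice : Fin t → Fin a → Fin q
  choice = [ finToFun , (λ _ _ → fzero) ]′ ∘ splitAt (q ^ a)

  lists : Fin (a + t) → List ℕ
  lists = [ block , transversal ∘ choice ]′ ∘ splitAt a

  lists-↑ˡ : ∀ i → lists (i ↑ˡ t) ≡ block i
  lists-↑ˡ i = cong [ block , transversal ∘ choice ]′ (splitAt-↑ˡ a i t)

  lists-↑ʳ : ∀ j → lists (a ↑ʳ j) ≡ transversal (choice j)
  lists-↑ʳ j = cong [ block , transversal ∘ choice ]′ (splitAt-↑ʳ a t j)

  transversal-realised : ∀ f → lists (a ↑ʳ (funToFin f ↑ˡ a)) ≡ transversal f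
  transversal-realised f = begin
    lists (a ↑ʳ (funToFin f ↑ˡ a))          ≡⟨ lists-↑ʳ (funToFin f ↑ˡ a) ⟩
    transversal (choice (funToFin f ↑ˡ a))  ≡⟨ cong (transversal ∘ [ finToFun , _ ]′)
                                                    (splitAt-↑ˡ (q ^ a) (funToFin f) a) ⟩
    transversal (finToFun (funToFin f))     ≡⟨ map-cong (λ i → cong (colour i) (finToFun-funToFin f i))
                                                        (allFin a) ⟩
    transversal f                           ∎
    where open ≡-Reasoning

  block-unique : ∀ i → Unique (block i)
  block-unique i = map⁺ (proj₂ ∘ colour-injective) (allFin⁺ q)

  transversal-unique : ∀ f → Unique (transversal f)
  transversal-unique f = map⁺ (proj₁ ∘ colour-injective) (allFin⁺ a)

  length-block : ∀ i → length (block i) ≡ q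
  length-block i = trans (length-map (colour i) (allFin q)) (length-tabulate (λ d → d))

  length-transversal : ∀ f → length (transversal f) ≡ a
  length-transversal f = trans (length-map _ (allFin a)) (length-tabulate (λ i → i))

  lists-unique : ∀ v → Unique (lists v)
  lists-unique v with side a t v
  ... | left i  = subst Unique (sym (lists-↑ˡ i)) (block-unique i)
  ... | right j = subst Unique (sym (lists-↑ʳ j)) (transversal-unique (choice j))

  lists-long : ∀ v → q ⊓ degree (K a t) v ≤ length (lists v)
  lists-long v with side a t v
  ... | left i  = ≤-trans (m⊓n≤m q _)
                    (≤-reflexive (sym (trans (cong length (lists-↑ˡ i)) (length-block i))))
  ... | right j = ≤-trans (m⊓n≤n q _) (≤-trans (K-degree-↑ʳ a t j)
                    (≤-reflexive (sym (trans (cong length (lists-↑ʳ j)) (length-transversal _)))))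

  K-not-choosable : ¬ TruncDegChoosable q (K a t)
  K-not-choosable choosable
    with φ , φ∈lists , proper ← choosable lists lists-unique lists-long = clash
    where
    picked : ∀ i → ∃ λ d → d ∈ᴸ allFin q × φ (i ↑ˡ t) ≡ colour i d
    picked i = ∈-map⁻ (colour i) (subst (φ (i ↑ˡ t) ∈ᴸ_) (lists-↑ˡ i) (φ∈lists (i ↑ˡ t)))

    f : Fin a → Fin q
    f = proj₁ ∘ picked

    b : Fin (a + t)
    b = a ↑ʳ (funToFin f ↑ˡ a)

    clash : ⊥
    clash
      with i , _ , φb≡ ← ∈-map⁻ _ (subst (φ b ∈ᴸ_) (transversal-realised f) (φ∈lists b)) =
      proper (i ↑ˡ t) b (K-edge a t i _) (trans (proj₂ (proj₂ (picked i))) (sym φb≡))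

  t-positive : 1 ≤ t
  t-positive = ≤-trans (m^n>0 q a) (m≤m+n (q ^ a) a)

  K-witness : Connected a (K a t) × ¬ TruncDegChoosable q (K a t)
  K-witness = K-connected a t t-positive (m≤n+m a (q ^ a)) , K-not-choosable

open TransversalLists using (t-positive; K-witness)

mainTheorem7 : (𝒢 : Family) → Proper 𝒢 → MinorClosed 𝒢 →
    (∃ λ G → 𝒢 G × 0 < n G) →
    (s : ℕ) →
    (∃ λ t → 1 ≤ t × ¬ 𝒢 (K s t)) →
    (∀ s′ → s′ < s → ∀ t → 1 ≤ t → 𝒢 (K s′ t)) →
    ∀ k → 1 ≤ k →
    ∃ λ G → 𝒢 G × Connected (s ∸ 1) G × ¬ TruncDegChoosable k G
mainTheorem7 𝒢 _ minor-closed (G , G∈𝒢 , 0<∣G∣) zero _ _ (suc k) _ =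
  K 0 1 , minor-closed G (K 0 1) (K₀₁-minor G (fromℕ< 0<∣G∣)) G∈𝒢 , K-witness 0 k
mainTheorem7 𝒢 _ _ _ (suc a) _ K-below-s (suc k) _ =
  K a (TransversalLists.t a k) , K-below-s a ≤-refl _ (t-positive a k) , K-witness a k
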